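{- Let $G=(V,E)$ be a connected trivalent graph. (a) The graph curve matroid $M_G$ is loopless if and only if $G$ is $2$-edge-connected. (b) If $G$ is $2$-edge-connected, then every circuit $C\subseteq V$ of $M_G$ satisfies $r^*(\delta(C))=|C|$.
   Context: Graphs are finite and undirected and may have parallel edges and loops; trivalent means every vertex has degree $3$. A connected graph is $2$-edge-connected if deleting any single edge leaves it connected. $r^*$ is the rank function of the bond (cographic) matroid of $G$, the dual of the cycle matroid. For $A\subseteq V$, $\delta(A)$ is the set of edges incident to at least one vertex of $A$. The graph curve matroid $M_G$ is the matroid on ground set $V$ whose circuits are the non-empty subsets $A\subseteq V$ that are inclusion-minimal among non-empty subsets satisfying $r^*(\delta(A))\le|A|$. -}

module Defs where

open import Data.Nat using (ℕ; _+_; _≤_)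
open import Data.Bool using (Bool; true; false; _∨_)
open import Data.Fin using (Fin)
open import Data.Fin.Properties using (_≟_)
open import Data.Fin.Subset using (Subset; _∈_; _⊆_; ∁; ⁅_⁆; ⊤; ∣_∣; Nonempty)
open import Data.Vec using (lookup; tabulate)
open import Data.List using (map; allFin)
open import Data.Nat.ListAction using (sum)
open import Data.Product using (Σ; _×_; _,_; proj₁; proj₂; ∃)
open import Data.Sum using (_⊎_)
open import Relation.Nullary using (¬_; does)
open import Relation.Binary.PropositionalEquality using (_≡_)
open import Relation.Binary.Construct.Closure.ReflexiveTransitive using (Star)

-- A finite multigraph (parallel edges and loops allowed):
-- vertices Fin nV, edges Fin nE, each edge has an (unordered) pair of endpoints.
record Graph : Set where
  field
    nV   : ℕ
    nE   : ℕ
    ends : Fin nE → Fin nV × Fin nV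
open Graph public

module _ (G : Graph) where

  V : Set
  V = Fin (nV G)

  E : Set
  E = Fin (nE G)

  incidence : V → E → ℕ
  incidence v e with does (proj₁ (ends G e) ≟ v) | does (proj₂ (ends G e) ≟ v)
  ... | true  | true  = 2
  ... | true  | false = 1
  ... | false | true  = 1
  ... | false | false = 0

  degree : V → ℕ
  degree v = sum (map (incidence v) (allFin (nE G)))

  Trivalent : Set
  Trivalent = ∀ v → degree v ≡ 3

  Adj : Subset (nE G) → V → V → Set
  Adj S x y = ∃ λ e → e ∈ S × (ends G e ≡ (x , y) ⊎ ends G e ≡ (y , x))

  Reach : Subset (nE G) → V → V → Set
  Reach S = Star (Adj S)

  ConnectedOn : Subset (nE G) → Set
  ConnectedOn S = ∀ u v → Reach S u v

  Connected : Set
  Connected = ConnectedOn ⊤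

  TwoEdgeConnected : Set
  TwoEdgeConnected = Connected × (∀ e → ConnectedOn (∁ ⁅ e ⁆))

  -- independent sets of the bond (cographic) matroid M*(G):
  -- Y is coindependent iff E \ Y is spanning in the cycle matroid,
  -- i.e. deleting Y does not disconnect any pair of connected vertices.
  CoIndependent : Subset (nE G) → Set
  CoIndependent Y = ∀ u v → Reach ⊤ u v → Reach (∁ Y) u v

  -- r*(X) ≤ k   (r* = max size of a coindependent subset of X)
  CoRankLe : Subset (nE G) → ℕ → Set
  CoRankLe X k = ∀ Y → Y ⊆ X → CoIndependent Y → ∣ Y ∣ ≤ k

  CoRankEq : Subset (nE G) → ℕ → Set
  CoRankEq X k = CoRankLe X k × (∃ λ Y → Y ⊆ X × CoIndependent Y × ∣ Y ∣ ≡ k)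

  δ : Subset (nV G) → Subset (nE G)
  δ A = tabulate λ e → lookup A (proj₁ (ends G e)) ∨ lookup A (proj₂ (ends G e))

  Dep : Subset (nV G) → Set
  Dep A = CoRankLe (δ A) ∣ A ∣

  IsCircuit : Subset (nV G) → Set
  IsCircuit C = Nonempty C × Dep C × (∀ B → Nonempty B → B ⊆ C → Dep B → B ≡ C)

  Loopless : Set
  Loopless = ∀ C → IsCircuit C → ¬ (∣ C ∣ ≡ 1)

{-# OPTIONS --safe #-}
-- Deleting a set Y ⊆ δ(v) of edges keeps G connected exactly when Y is coindependent, so
-- r*(δ{v}) ≥ 2 says that {v} is independent in M_G. At a vertex v of a trivalent bridgeless graph
-- the three edges are non-loops to neighbours x, y, z, and these lie in one component of G − δ(v),
-- since otherwise an edge at v would be a bridge; hence deleting two edges at v keeps G connected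
-- and M_G has no loops. Conversely, if e is a bridge with end p, every pair of edges at p either
-- contains e or leaves p attached to the rest of G through e alone, so r*(δ{p}) ≤ 1 and {p} is a
-- loop. For (b), a circuit C has at least two elements, C minus one of them is independent, and so
-- δ(C) contains a coindependent set of size |C|. Reachability in a finite graph is decidable, which
-- turns the case distinctions and the rank witnesses into finite searches.
module Submission where

open import Defs
open import Data.Product using (_×_)
open import Data.Fin.Subset using (∣_∣)
open import Function.Bundles using (_⇔_)

open import Algebra.Properties.CommutativeSemigroup using (x∙yz≈y∙xz)
open import Data.Bool using (true; false; _∨_)
open import Data.Bool.Properties using (∨-zeroʳ)
open import Data.Empty using (⊥; ⊥-elim)
open import Data.Fin using (Fin; zero; suc)
open import Data.Fin.Properties using (_≟_; any?; all?; suc-injective)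
open import Data.Fin.Subset
  using (Subset; _∈_; _∉_; _⊆_; ∁; ⁅_⁆; ⊤; _∪_; _-_; Nonempty; inside; outside)
open import Data.Fin.Subset.Properties
  using ( _∈?_; _⊆?_; x∈⁅x⁆; x∈⁅y⁆⇒x≡y; x≢y⇒x∉⁅y⁆; ∣⁅x⁆∣≡1; ∣p∣≤n; p⊂q⇒∣p∣<∣q∣
        ; x∈∁p⇒x∉p; x∉p⇒x∈∁p; x∉∁p⇒x∈p; p⊆q⇒∁p⊇∁q; x∈p∪q⁻; x∈p∪q⁺; p⊆p∪q
        ; p─q⊆p; p─⊥≡p; ⊆-antisym; anySubset?; out⊆; s⊆s )
open import Data.List using ([]; _∷_; map; length)
import Data.List as List
open import Data.List.Properties using (map-tabulate)
open import Data.List.Membership.Propositional using () renaming (_∈_ to _∈ₗ_)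
open import Data.List.Relation.Binary.Permutation.Propositional using (↭-swap; ↭-refl)
open import Data.List.Relation.Binary.Permutation.Propositional.Properties using (∈-resp-↭)
open import Data.List.Relation.Unary.All using (All; []; _∷_)
import Data.List.Relation.Unary.All as All
open import Data.List.Relation.Unary.All.Properties using (¬Any⇒All¬)
open import Data.List.Relation.Unary.AllPairs using ([]; _∷_)
open import Data.List.Relation.Unary.Any using (here; there)
import Data.List.Relation.Unary.Any as Any
open import Data.List.Relation.Unary.Unique.Propositional using (Unique)
open import Data.Nat using (ℕ; zero; suc; _+_; _≤_; _<_; _≤?_; z≤n; s≤s; z<s)
open import Data.Nat.ListAction using (sum)
open import Data.Nat.Properties
  using ( ≤-refl; ≤-trans; ≤-antisym; <⇒≱; ≮⇒≥; ≰⇒>; 1+n≢n; n≢0⇒n>0; m+n≤o⇒n≤o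
        ; +-identityʳ; +-mono-≤; +-monoʳ-≤; +-cancelʳ-≤; +-cancelˡ-<; +-commutativeSemigroup
        ; module ≤-Reasoning )
open import Data.Product using (∃; ∃₂; _,_; proj₁; proj₂)
import Data.Product as Product
open import Data.Product.Properties using (≡-dec; ,-injectiveˡ; ,-injectiveʳ)
open import Data.Sum using (_⊎_; inj₁; inj₂)
import Data.Sum as Sum
open import Data.Vec using (_∷_; []; tabulate; lookup; here; there)
open import Data.Vec.Functional using (updateAt)
open import Data.Vec.Functional.Properties using (updateAt-updates; updateAt-minimal)
open import Data.Vec.Properties using ([]=⇒lookup; lookup⇒[]=; lookup∘tabulate)
open import Function using (_∘_; const; id)
open import Function.Bundles using (mk⇔)
open import Relation.Binary.Construct.Closure.ReflexiveTransitive using (Star; ε; _◅_; _◅◅_; reverse)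
import Relation.Binary.Construct.Closure.ReflexiveTransitive as Star
open import Relation.Binary.PropositionalEquality
  using (_≡_; _≢_; refl; sym; trans; cong; cong₂; subst; subst₂; ≢-sym)
open import Relation.Nullary using (¬_; Dec; yes; no; does; _×-dec_; _⊎-dec_; _→-dec_; ¬?)
open import Relation.Nullary.Decidable using (dec-true; decidable-stable)
open import Relation.Nullary.Negation using (contradiction)

-- Sums of multiplicities

∑ : ∀ {n} → (Fin n → ℕ) → ℕ
∑ f = sum (List.tabulate f)

erase : ∀ {n} → (Fin n → ℕ) → Fin n → Fin n → ℕ
erase f i = updateAt f i (const 0)

∑-erase : ∀ {n} (f : Fin n → ℕ) i → ∑ f ≡ f i + ∑ (erase f i)
∑-erase f zero    = refl
∑-erase f (suc i) =
  trans (cong (f zero +_) (∑-erase (f ∘ suc) i)) (x∙yz≈y∙xz +-commutativeSemigroup (f zero) (f (suc i)) _)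

sum-erase : ∀ {n} (f : Fin n → ℕ) {i is} → All (i ≢_) is → sum (map (erase f i) is) ≡ sum (map f is)
sum-erase f []                 = refl
sum-erase f {i} (i≢j ∷ i≢js) = cong₂ _+_ (updateAt-minimal _ i f (≢-sym i≢j)) (sum-erase f i≢js)

erase-positive : ∀ {n} (f : Fin n → ℕ) {i j} → 0 < erase f i j → j ≢ i
erase-positive f {i} pos refl with () ← subst (0 <_) (updateAt-updates i f) pos

sum≤∑ : ∀ {n} (f : Fin n → ℕ) {is} → Unique is → sum (map f is) ≤ ∑ f
sum≤∑ f []                     = z≤n
sum≤∑ f {i ∷ is} (i∉is ∷ uniq) = begin
  f i + sum (map f is)            ≡⟨ cong (f i +_) (sym (sum-erase f i∉is)) ⟩
  f i + sum (map (erase f i) is)  ≤⟨ +-monoʳ-≤ (f i) (sum≤∑ (erase f i) uniq) ⟩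
  f i + ∑ (erase f i)             ≡⟨ sym (∑-erase f i) ⟩
  ∑ f                             ∎
  where open ≤-Reasoning

length≤sum : ∀ {n} (f : Fin n → ℕ) {is} → All (λ i → 0 < f i) is → length is ≤ sum (map f is)
length≤sum f []         = z≤n
length≤sum f (pos ∷ ps) = +-mono-≤ pos (length≤sum f ps)

∑-positive : ∀ {n} (f : Fin n → ℕ) → 0 < ∑ f → ∃ λ i → 0 < f i
∑-positive {suc n} f pos with f zero in f0≡
... | suc _ = zero , subst (0 <_) (sym f0≡) z<s
... | zero  = Product.map suc id (∑-positive (f ∘ suc) pos)

sum<∑⇒fresh : ∀ {n} (f : Fin n → ℕ) {is} → Unique is → sum (map f is) < ∑ f →
              ∃ λ j → All (j ≢_) is × 0 < f j
sum<∑⇒fresh f []                     lt = Product.map₂ ([] ,_) (∑-positive f lt)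
sum<∑⇒fresh f {i ∷ is} (i∉is ∷ uniq) lt =
  let j , j∉is , pos = sum<∑⇒fresh (erase f i) uniq rest<
      j≢i            = erase-positive f pos
  in j , j≢i ∷ j∉is , subst (0 <_) (updateAt-minimal j i f j≢i) pos
  where
  rest< : sum (map (erase f i) is) < ∑ (erase f i)
  rest< = +-cancelˡ-< (f i) _ _ (subst₂ _<_ (cong (f i +_) (sym (sum-erase f i∉is))) (∑-erase f i) lt)

sum≡∑⇒covers : ∀ {n} (f : Fin n → ℕ) {is} → Unique is → sum (map f is) ≡ ∑ f →
               ∀ j → 0 < f j → j ∈ₗ is
sum≡∑⇒covers f {is} uniq sum≡∑ j pos with Any.any? (j ≟_) is
... | yes j∈is = j∈is
... | no  j∉is = contradiction (≤-trans pos fj≤0) λ ()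
  where
  fj≤0 : f j ≤ 0
  fj≤0 = +-cancelʳ-≤ (sum (map f is)) (f j) 0
           (subst (f j + sum (map f is) ≤_) (sym sum≡∑) (sum≤∑ f (¬Any⇒All¬ is j∉is ∷ uniq)))

data Split {n} (f : Fin n → ℕ) : Set where
  two+one     : ∀ i j → f i ≡ 2 → f j ≡ 1 → (∀ k → 0 < f k → k ∈ₗ i ∷ j ∷ []) → Split f
  one+one+one : ∀ i j k → Unique (i ∷ j ∷ k ∷ []) → f i ≡ 1 → f j ≡ 1 → f k ≡ 1 →
                (∀ l → 0 < f l → l ∈ₗ i ∷ j ∷ k ∷ []) → Split f

private
  two-summands : ∀ x y → 0 < x → 0 < y → x + (y + 0) ≤ 3 →
                 (x ≡ 2 × y ≡ 1) ⊎ (x ≡ 1 × y ≡ 2) ⊎ (x ≡ 1 × y ≡ 1)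
  two-summands 1 1 _ _ _ = inj₂ (inj₂ (refl , refl))
  two-summands 1 2 _ _ _ = inj₂ (inj₁ (refl , refl))
  two-summands 2 1 _ _ _ = inj₁ (refl , refl)
  two-summands 1 (suc (suc (suc _))) _ _ (s≤s (s≤s (s≤s ())))
  two-summands 2 (suc (suc _))       _ _ (s≤s (s≤s (s≤s ())))
  two-summands (suc (suc (suc x))) (suc y) _ _ (s≤s (s≤s (s≤s le))) with () ← m+n≤o⇒n≤o x le

  third-summand : ∀ z → 0 < z → z + 2 ≤ 3 → z ≡ 1
  third-summand 1             _ _                  = refl
  third-summand (suc (suc z)) _ (s≤s (s≤s z+2≤1)) with s≤s () ← m+n≤o⇒n≤o z z+2≤1

split : ∀ {n} (f : Fin n → ℕ) → (∀ i → f i ≤ 2) → ∑ f ≡ 3 → Split f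
split f ≤2 ∑≡3 =
  let i , _   , 0<fi = sum<∑⇒fresh f [] (subst (0 <_) (sym ∑≡3) z<s)
      j , j∉i , 0<fj = sum<∑⇒fresh f ([] ∷ [])
                         (subst₂ _<_ (sym (+-identityʳ (f i))) (sym ∑≡3) (s≤s (≤2 i)))
      uniq           = (≢-sym (All.head j∉i) ∷ []) ∷ [] ∷ []
  in from-pair i j uniq (two-summands (f i) (f j) 0<fi 0<fj (bound uniq))
  where
  pair-sum : ∀ {i j a b} → f i ≡ a → f j ≡ b → sum (map f (i ∷ j ∷ [])) ≡ a + (b + 0)
  pair-sum = cong₂ λ x y → x + (y + 0)

  covers : ∀ {is} → Unique is → sum (map f is) ≡ 3 → ∀ k → 0 < f k → k ∈ₗ is
  covers uniq sum≡3 = sum≡∑⇒covers f uniq (trans sum≡3 (sym ∑≡3))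

  bound : ∀ {is} → Unique is → sum (map f is) ≤ 3
  bound {is} uniq = subst (sum (map f is) ≤_) ∑≡3 (sum≤∑ f uniq)

  from-pair : ∀ i j → Unique (i ∷ j ∷ []) →
              (f i ≡ 2 × f j ≡ 1) ⊎ (f i ≡ 1 × f j ≡ 2) ⊎ (f i ≡ 1 × f j ≡ 1) → Split f
  from-pair i j uniq (inj₁ (fi≡2 , fj≡1)) =
    two+one i j fi≡2 fj≡1 (covers uniq (pair-sum fi≡2 fj≡1))
  from-pair i j ((i≢j ∷ []) ∷ _) (inj₂ (inj₁ (fi≡1 , fj≡2))) =
    two+one j i fj≡2 fi≡1 (covers ((≢-sym i≢j ∷ []) ∷ [] ∷ []) (pair-sum fj≡2 fi≡1))
  from-pair i j uniq (inj₂ (inj₂ (fi≡1 , fj≡1))) =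
    let k , k∉ij , 0<fk = sum<∑⇒fresh f uniq (subst₂ _<_ (sym (pair-sum fi≡1 fj≡1)) (sym ∑≡3) ≤-refl)
        uniq₃           = k∉ij ∷ uniq
        fk≡1            = third-summand (f k) 0<fk
                            (subst (λ s → f k + s ≤ 3) (pair-sum fi≡1 fj≡1) (bound uniq₃))
    in one+one+one k i j uniq₃ fk≡1 fi≡1 fj≡1 (covers uniq₃ (cong₂ _+_ fk≡1 (pair-sum fi≡1 fj≡1)))

-- Finite subsets

module _ {n : ℕ} where

  select : {P : Fin n → Set} → (∀ x → Dec (P x)) → Subset n
  select P? = tabulate (does ∘ P?)

  ∈select⁺ : ∀ {P : Fin n → Set} (P? : ∀ x → Dec (P x)) {x} → P x → x ∈ select P?
  ∈select⁺ P? {x} px = lookup⇒[]= x _ (trans (lookup∘tabulate _ x) (dec-true (P? x) px))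

  ∈select⁻ : ∀ {P : Fin n → Set} (P? : ∀ x → Dec (P x)) {x} → x ∈ select P? → P x
  ∈select⁻ P? {x} x∈ with P? x | trans (sym (lookup∘tabulate (does ∘ P?) x)) ([]=⇒lookup x∈)
  ... | yes px | _ = px

  x∈p⇒⁅x⁆⊆p : ∀ {x : Fin n} {p} → x ∈ p → ⁅ x ⁆ ⊆ p
  x∈p⇒⁅x⁆⊆p {x} x∈p y∈⁅x⁆ = subst (_∈ _) (sym (x∈⁅y⁆⇒x≡y x y∈⁅x⁆)) x∈p

  ∈∁⁅⁆⇒≢ : ∀ {x y : Fin n} → x ∈ ∁ ⁅ y ⁆ → x ≢ y
  ∈∁⁅⁆⇒≢ {y = y} x∈ refl = x∈∁p⇒x∉p x∈ (x∈⁅x⁆ y)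

  ≢⇒∈∁⁅⁆ : ∀ {x y : Fin n} → x ≢ y → x ∈ ∁ ⁅ y ⁆
  ≢⇒∈∁⁅⁆ = x∉p⇒x∈∁p ∘ x≢y⇒x∉⁅y⁆

  ∉∁⁅⁆⇒≡ : ∀ {x y : Fin n} → x ∉ ∁ ⁅ y ⁆ → x ≡ y
  ∉∁⁅⁆⇒≡ = x∈⁅y⁆⇒x≡y _ ∘ x∉∁p⇒x∈p

  nonempty⊆⁅x⁆⇒≡ : ∀ {p} {x : Fin n} → Nonempty p → p ⊆ ⁅ x ⁆ → p ≡ ⁅ x ⁆
  nonempty⊆⁅x⁆⇒≡ {p} {x} (z , z∈p) p⊆⁅x⁆ = ⊆-antisym p⊆⁅x⁆ λ y∈⁅x⁆ →
    subst (_∈ p) (trans (x∈⁅y⁆⇒x≡y x (p⊆⁅x⁆ z∈p)) (sym (x∈⁅y⁆⇒x≡y x y∈⁅x⁆))) z∈p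

  2≤∣⁅x⁆∪⁅y⁆∣ : ∀ {x y : Fin n} → x ≢ y → 2 ≤ ∣ ⁅ x ⁆ ∪ ⁅ y ⁆ ∣
  2≤∣⁅x⁆∪⁅y⁆∣ {x} {y} x≢y = subst (_< ∣ ⁅ x ⁆ ∪ ⁅ y ⁆ ∣) (∣⁅x⁆∣≡1 x)
    (p⊂q⇒∣p∣<∣q∣ (p⊆p∪q _ , y , x∈p∪q⁺ (inj₂ (x∈⁅x⁆ y)) , x≢y⇒x∉⁅y⁆ (≢-sym x≢y)))

∣p∣≡1+∣p-x∣ : ∀ {n} (p : Subset n) {x} → x ∈ p → ∣ p ∣ ≡ suc ∣ p - x ∣
∣p∣≡1+∣p-x∣ (inside  ∷ p) here        = cong suc (cong ∣_∣ (sym (p─⊥≡p p)))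
∣p∣≡1+∣p-x∣ (inside  ∷ p) (there x∈p) = cong suc (∣p∣≡1+∣p-x∣ p x∈p)
∣p∣≡1+∣p-x∣ (outside ∷ p) (there x∈p) = ∣p∣≡1+∣p-x∣ p x∈p

nonempty-of-size : ∀ {n} (p : Subset n) → 1 ≤ ∣ p ∣ → Nonempty p
nonempty-of-size (inside  ∷ p) _     = zero , here
nonempty-of-size (outside ∷ p) 1≤∣p∣ = Product.map suc there (nonempty-of-size p 1≤∣p∣)

two-members : ∀ {n} (p : Subset n) → 2 ≤ ∣ p ∣ → ∃₂ λ x y → x ∈ p × y ∈ p × x ≢ y
two-members (inside ∷ p) (s≤s 1≤∣p∣) =
  let y , y∈p = nonempty-of-size p 1≤∣p∣ in zero , suc y , here , there y∈p , λ ()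
two-members (outside ∷ p) 2≤∣p∣ =
  let x , y , x∈p , y∈p , x≢y = two-members p 2≤∣p∣
  in suc x , suc y , there x∈p , there y∈p , x≢y ∘ suc-injective

subset-of-size : ∀ {n} (p : Subset n) {k} → k ≤ ∣ p ∣ → ∃ λ q → q ⊆ p × ∣ q ∣ ≡ k
subset-of-size [] z≤n = [] , id , refl
subset-of-size (outside ∷ p) k≤∣p∣ =
  let q , q⊆p , ∣q∣≡k = subset-of-size p k≤∣p∣ in outside ∷ q , s⊆s q⊆p , ∣q∣≡k
subset-of-size (inside ∷ p) {zero} _ =
  let q , q⊆p , ∣q∣≡0 = subset-of-size p z≤n in outside ∷ q , out⊆ q⊆p , ∣q∣≡0
subset-of-size (inside ∷ p) {suc k} (s≤s k≤∣p∣) =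
  let q , q⊆p , ∣q∣≡k = subset-of-size p k≤∣p∣ in inside ∷ q , s⊆s q⊆p , cong suc ∣q∣≡k

-- Decidable reachability

module _ {n : ℕ} {R : Fin n → Fin n → Set} (R? : ∀ x y → Dec (R x y)) where

  private
    Closed : Subset n → Set
    Closed X = ∀ {x y} → x ∈ X → R x y → y ∈ X

    Step : Subset n → Fin n → Set
    Step X y = y ∈ X ⊎ ∃ λ x → x ∈ X × R x y

    Step? : ∀ X y → Dec (Step X y)
    Step? X y = y ∈? X ⊎-dec any? λ x → x ∈? X ×-dec R? x y

    expand : Subset n → Subset n
    expand X = select (Step? X)

    ∈expand⁺ : ∀ {X y} → Step X y → y ∈ expand X
    ∈expand⁺ {X} = ∈select⁺ (Step? X)

    ∈expand⁻ : ∀ {X y} → y ∈ expand X → Step X y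
    ∈expand⁻ {X} = ∈select⁻ (Step? X)

    expand-closed : ∀ {X} → Closed X → Closed (expand X)
    expand-closed closed x∈ r with ∈expand⁻ x∈
    ... | inj₁ x∈X            = ∈expand⁺ (inj₁ (closed x∈X r))
    ... | inj₂ (w , w∈X , r′) = ∈expand⁺ (inj₁ (closed (closed w∈X r′) r))

    expand-grows : ∀ X → Closed X ⊎ ∣ X ∣ < ∣ expand X ∣
    expand-grows X with any? (λ x → any? λ y → x ∈? X ×-dec R? x y ×-dec ¬? (y ∈? X))
    ... | yes (x , y , x∈X , r , y∉X) =
      inj₂ (p⊂q⇒∣p∣<∣q∣ (∈expand⁺ ∘ inj₁ , y , ∈expand⁺ (inj₂ (x , x∈X , r)) , y∉X))
    ... | no ¬escape =
      inj₁ λ {x} {y} x∈X r → decidable-stable (y ∈? X) λ y∉X → ¬escape (x , y , x∈X , r , y∉X)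

    ball : Fin n → ℕ → Subset n
    ball u zero    = ⁅ u ⁆
    ball u (suc k) = expand (ball u k)

    ball-reachable : ∀ {u} k {y} → y ∈ ball u k → Star R u y
    ball-reachable zero y∈ rewrite x∈⁅y⁆⇒x≡y _ y∈ = ε
    ball-reachable (suc k) y∈ with ∈expand⁻ y∈
    ... | inj₁ y∈ball           = ball-reachable k y∈ball
    ... | inj₂ (x , x∈ball , r) = ball-reachable k x∈ball ◅◅ (r ◅ ε)

    centre∈ball : ∀ u k → u ∈ ball u k
    centre∈ball u zero    = x∈⁅x⁆ u
    centre∈ball u (suc k) = ∈expand⁺ (inj₁ (centre∈ball u k))

    ball-closed-or-large : ∀ u k → Closed (ball u k) ⊎ k ≤ ∣ ball u k ∣
    ball-closed-or-large u zero = inj₂ z≤n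
    ball-closed-or-large u (suc k) with ball-closed-or-large u k | expand-grows (ball u k)
    ... | inj₁ closed | _           = inj₁ (expand-closed closed)
    ... | inj₂ _      | inj₁ closed = inj₁ (expand-closed closed)
    ... | inj₂ large  | inj₂ grows  = inj₂ (≤-trans (s≤s large) grows)

    ball-closed : ∀ u → Closed (ball u (suc n))
    ball-closed u with ball-closed-or-large u (suc n)
    ... | inj₁ closed = closed
    ... | inj₂ large  = contradiction (∣p∣≤n (ball u (suc n))) (<⇒≱ large)

    closed-reach : ∀ {X x y} → Closed X → x ∈ X → Star R x y → y ∈ X
    closed-reach closed x∈ ε        = x∈
    closed-reach closed x∈ (r ◅ rs) = closed-reach closed (closed x∈ r) rs

  Star? : ∀ x y → Dec (Star R x y)
  Star? x y with y ∈? ball x (suc n)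
  ... | yes y∈ = yes (ball-reachable (suc n) y∈)
  ... | no  y∉ = no λ path → y∉ (closed-reach (ball-closed x) (centre∈ball x (suc n)) path)

-- Reachability and cuts in multigraphs

module _ (G : Graph) where

  Joins : E G → V G → V G → Set
  Joins e x y = ends G e ≡ (x , y) ⊎ ends G e ≡ (y , x)

  Bridgeless : Set
  Bridgeless = ∀ e → ConnectedOn G (∁ ⁅ e ⁆)

  awayFrom : V G → Subset (nE G)
  awayFrom v = ∁ (δ G ⁅ v ⁆)

  joins-sym : ∀ {e x y} → Joins e x y → Joins e y x
  joins-sym = Sum.swap

  joins-endpoint : ∀ {e v w x y} → Joins e v w → Joins e x y → x ≡ v ⊎ x ≡ w
  joins-endpoint (inj₁ e≡vw) (inj₁ e≡xy) = inj₁ (,-injectiveˡ (trans (sym e≡xy) e≡vw))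
  joins-endpoint (inj₁ e≡vw) (inj₂ e≡yx) = inj₂ (,-injectiveʳ (trans (sym e≡yx) e≡vw))
  joins-endpoint (inj₂ e≡wv) (inj₁ e≡xy) = inj₂ (,-injectiveˡ (trans (sym e≡xy) e≡wv))
  joins-endpoint (inj₂ e≡wv) (inj₂ e≡yx) = inj₁ (,-injectiveʳ (trans (sym e≡yx) e≡wv))

  joins? : ∀ e x y → Dec (Joins e x y)
  joins? e x y = ≡-dec _≟_ _≟_ (ends G e) (x , y) ⊎-dec ≡-dec _≟_ _≟_ (ends G e) (y , x)

  edge : ∀ {S e x y} → e ∈ S → Joins e x y → Reach G S x y
  edge e∈S j = (_ , e∈S , j) ◅ ε

  reach-sym : ∀ {S x y} → Reach G S x y → Reach G S y x
  reach-sym = reverse λ (e , e∈S , j) → e , e∈S , joins-sym j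

  reach-mono : ∀ {S S′} → S ⊆ S′ → ∀ {x y} → Reach G S x y → Reach G S′ x y
  reach-mono S⊆S′ = Star.map (Product.map₂ (Product.map₁ S⊆S′))

  reach-along : ∀ {S e v w x y} → Joins e v w → Reach G S v w → Joins e x y → Reach G S x y
  reach-along (inj₁ e≡vw) path (inj₁ e≡xy) with refl ← trans (sym e≡vw) e≡xy = path
  reach-along (inj₁ e≡vw) path (inj₂ e≡yx) with refl ← trans (sym e≡vw) e≡yx = reach-sym path
  reach-along (inj₂ e≡wv) path (inj₁ e≡xy) with refl ← trans (sym e≡wv) e≡xy = reach-sym path
  reach-along (inj₂ e≡wv) path (inj₂ e≡yx) with refl ← trans (sym e≡wv) e≡yx = path

  reroute : ∀ {S S′} → (∀ e → e ∈ S → e ∉ S′ → ∃₂ λ v w → Joins e v w × Reach G S′ v w) →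
            ∀ {x y} → Reach G S x y → Reach G S′ x y
  reroute detour ε = ε
  reroute {S′ = S′} detour ((e , e∈S , j) ◅ path) with e ∈? S′
  ... | yes e∈S′ = (e , e∈S′ , j) ◅ reroute detour path
  ... | no  e∉S′ = let _ , _ , j′ , around = detour e e∈S e∉S′
                   in reach-along j′ around j ◅◅ reroute detour path

  reach-within : ∀ {S T u} → (∀ e → e ∈ S → e ∉ T → ∀ {x y} → Joins e x y → ¬ Reach G T u x) →
                 ∀ {w} → Reach G S u w → Reach G T u w
  reach-within {S} {T} {u} blocked = extend ε
    where
    extend : ∀ {x w} → Reach G T u x → Reach G S x w → Reach G T u w
    extend u~x ε = u~x
    extend u~x ((e , e∈S , j) ◅ path) with e ∈? T
    ... | yes e∈T = extend (u~x ◅◅ edge e∈T j) path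
    ... | no  e∉T = contradiction u~x (blocked e e∈S e∉T j)

  stuck : ∀ {S v} → (∀ e → e ∈ S → ∀ {w} → Joins e v w → w ≡ v) → ∀ {w} → Reach G S v w → w ≡ v
  stuck loops ε = refl
  stuck loops ((e , e∈S , j) ◅ path) with refl ← loops e e∈S j = stuck loops path

  isolated : ∀ {T v} → (∀ e → e ∈ T → ∀ {w} → ¬ Joins e v w) → ∀ {u} → Reach G T u v → u ≡ v
  isolated no-edge path = stuck (λ e e∈T j → contradiction j (no-edge e e∈T)) (reach-sym path)

  reach? : ∀ S x y → Dec (Reach G S x y)
  reach? S = Star? λ x y → any? λ e → e ∈? S ×-dec joins? e x y

  connectedOn? : ∀ S → Dec (ConnectedOn G S)
  connectedOn? S = all? λ u → all? λ v → reach? S u v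

  coIndependent? : ∀ Y → Dec (CoIndependent G Y)
  coIndependent? Y = all? λ u → all? λ v → reach? ⊤ u v →-dec reach? (∁ Y) u v

  coIndependent-anti : ∀ {Y Y′} → Y′ ⊆ Y → CoIndependent G Y → CoIndependent G Y′
  coIndependent-anti Y′⊆Y coind u v path = reach-mono (p⊆q⇒∁p⊇∁q Y′⊆Y) (coind u v path)

  corank-exceeds : ∀ {X k} → ¬ CoRankLe G X k → ∃ λ Y → Y ⊆ X × CoIndependent G Y × ∣ Y ∣ ≡ suc k
  corank-exceeds {X} {k} ¬≤k
    with anySubset? (λ Y → Y ⊆? X ×-dec coIndependent? Y ×-dec suc k ≤? ∣ Y ∣)
  ... | yes (Y , Y⊆X , coind , k<∣Y∣) =
    let Y′ , Y′⊆Y , ∣Y′∣≡ = subset-of-size Y k<∣Y∣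
    in Y′ , (λ y∈Y′ → Y⊆X (Y′⊆Y y∈Y′)) , coIndependent-anti Y′⊆Y coind , ∣Y′∣≡
  ... | no none = contradiction ≤k ¬≤k
    where
    ≤k : CoRankLe G X k
    ≤k Y Y⊆X coind = ≮⇒≥ λ k<∣Y∣ → none (Y , Y⊆X , coind , k<∣Y∣)

  joins⇒∈δ : ∀ {A e v w} → v ∈ A → Joins e v w → e ∈ δ G A
  joins⇒∈δ {A} {e} {v} {w} v∈A j = lookup⇒[]= e (δ G A) (trans (lookup∘tabulate _ e) (ends∈A j))
    where
    ends∈A : Joins e v w → (lookup A (proj₁ (ends G e)) ∨ lookup A (proj₂ (ends G e))) ≡ true
    ends∈A (inj₁ e≡vw) rewrite e≡vw | []=⇒lookup v∈A = refl
    ends∈A (inj₂ e≡wv) rewrite e≡wv | []=⇒lookup v∈A = ∨-zeroʳ (lookup A w)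

  ∈δ⇒joins : ∀ {A e} → e ∈ δ G A → ∃₂ λ v w → v ∈ A × Joins e v w
  ∈δ⇒joins {A} {e} e∈δA = endpoint∈A (trans (sym (lookup∘tabulate _ e)) ([]=⇒lookup e∈δA))
    where
    endpoint∈A : (lookup A (proj₁ (ends G e)) ∨ lookup A (proj₂ (ends G e))) ≡ true →
                 ∃₂ λ v w → v ∈ A × Joins e v w
    endpoint∈A ∨≡true with lookup A (proj₁ (ends G e)) in first∈A
    ... | true  = _ , _ , lookup⇒[]= _ A first∈A , inj₁ refl
    ... | false = _ , _ , lookup⇒[]= _ A ∨≡true , inj₂ refl

  ∈δ⁅⁆⇒joins : ∀ {v e} → e ∈ δ G ⁅ v ⁆ → ∃ λ w → Joins e v w
  ∈δ⁅⁆⇒joins {v} {e} e∈δv =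
    let _ , w , v′∈⁅v⁆ , j = ∈δ⇒joins e∈δv in w , subst (λ u → Joins e u w) (x∈⁅y⁆⇒x≡y v v′∈⁅v⁆) j

  δ-mono : ∀ {A B} → A ⊆ B → δ G A ⊆ δ G B
  δ-mono A⊆B e∈δA = let _ , _ , v∈A , j = ∈δ⇒joins e∈δA in joins⇒∈δ (A⊆B v∈A) j

  incidence≤2 : ∀ v e → incidence G v e ≤ 2
  incidence≤2 v e with proj₁ (ends G e) ≟ v | proj₂ (ends G e) ≟ v
  ... | yes _ | yes _ = ≤-refl
  ... | yes _ | no  _ = s≤s z≤n
  ... | no  _ | yes _ = s≤s z≤n
  ... | no  _ | no  _ = z≤n

  joins⇒incident : ∀ {v e w} → Joins e v w → 0 < incidence G v e
  joins⇒incident {v} {e} j with proj₁ (ends G e) ≟ v | proj₂ (ends G e) ≟ v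
  ... | yes _      | yes _       = z<s
  ... | yes _      | no  _       = z<s
  ... | no  _      | yes _       = z<s
  ... | no first≢v | no second≢v with j
  ... | inj₁ e≡vw = contradiction (cong proj₁ e≡vw) first≢v
  ... | inj₂ e≡wv = contradiction (cong proj₂ e≡wv) second≢v

  ∈δ⁅⁆⇒incident : ∀ {v e} → e ∈ δ G ⁅ v ⁆ → 0 < incidence G v e
  ∈δ⁅⁆⇒incident = joins⇒incident ∘ proj₂ ∘ ∈δ⁅⁆⇒joins

  incidence≡1⇒spoke : ∀ {v e} → incidence G v e ≡ 1 → ∃ λ x → x ≢ v × Joins e v x
  incidence≡1⇒spoke {v} {e} inc≡1 with ends G e
  ... | p , q with p ≟ v | q ≟ v | inc≡1
  ... | yes refl | no q≢v   | _ = q , q≢v , inj₁ refl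
  ... | no p≢v   | yes refl | _ = p , p≢v , inj₂ refl

  incidence≡2⇒loop : ∀ {v e} → incidence G v e ≡ 2 → Joins e v v
  incidence≡2⇒loop {v} {e} inc≡2 with ends G e
  ... | p , q with p ≟ v | q ≟ v | inc≡2
  ... | yes refl | yes refl | _  = inj₁ refl
  ... | yes _    | no _     | ()
  ... | no _     | yes _    | ()
  ... | no _     | no _     | ()

  degree≡∑ : ∀ v → degree G v ≡ ∑ (incidence G v)
  degree≡∑ v = cong sum (map-tabulate id (incidence G v))

  connected-minus-edge : ∀ {e p q} → Connected G → Joins e p q → Reach G (∁ ⁅ e ⁆) p q →
                         ConnectedOn G (∁ ⁅ e ⁆)
  connected-minus-edge {e} conn je p~q u w = reroute detour (conn u w)
    where
    detour : ∀ h → h ∈ ⊤ → h ∉ ∁ ⁅ e ⁆ → ∃₂ λ v w → Joins h v w × Reach G (∁ ⁅ e ⁆) v w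
    detour h _ h∉ with refl ← ∉∁⁅⁆⇒≡ h∉ = _ , _ , je , p~q

  isolated-awayFrom : ∀ {u v} → Reach G (awayFrom v) u v → u ≡ v
  isolated-awayFrom {v = v} = isolated λ e e∈T j → x∈∁p⇒x∉p e∈T (joins⇒∈δ (x∈⁅x⁆ v) j)

  -- The component of y in G − δ(v) contains neither v nor the far end of any other edge at v,
  -- so b is the only edge leaving it.
  spoke-bridge : ∀ {v b y} → y ≢ v →
    (∀ h → h ∈ δ G ⁅ v ⁆ → h ≢ b → ∃ λ w → Joins h v w × ¬ Reach G (awayFrom v) y w) →
    ¬ Reach G (∁ ⁅ b ⁆) y v
  spoke-bridge {v} {b} {y} y≢v far path = y≢v (isolated-awayFrom (reach-within blocked path))
    where
    blocked : ∀ e → e ∈ ∁ ⁅ b ⁆ → e ∉ awayFrom v → ∀ {x x′} → Joins e x x′ →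
              ¬ Reach G (awayFrom v) y x
    blocked e e∈ e∉ j with w , j′ , y↛w ← far e (x∉∁p⇒x∈p e∉) (∈∁⁅⁆⇒≢ e∈) with joins-endpoint j′ j
    ... | inj₁ refl = y≢v ∘ isolated-awayFrom
    ... | inj₂ refl = y↛w

  loop+spoke-bridge : ∀ {v l e x} → Joins l v v → (∀ h → h ∈ δ G ⁅ v ⁆ → h ∈ₗ l ∷ e ∷ []) →
                      x ≢ v → ¬ Reach G (∁ ⁅ e ⁆) v x
  loop+spoke-bridge {v} {l} {e} jl only x≢v path = x≢v (stuck loop-only path)
    where
    loop-only : ∀ h → h ∈ ∁ ⁅ e ⁆ → ∀ {w} → Joins h v w → w ≡ v
    loop-only h h∈ j with only h (joins⇒∈δ (x∈⁅x⁆ v) j)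
    ... | here refl         = Sum.reduce (joins-endpoint jl (joins-sym j))
    ... | there (here refl) = contradiction refl (∈∁⁅⁆⇒≢ h∈)

  -- Otherwise the component of y or of z in G − δ(v) avoids the other two neighbours of v,
  -- and the edge b or c leading into it is a bridge.
  spokes-linked : Bridgeless → ∀ {v a b c x y z} →
    y ≢ v → z ≢ v → Joins a v x → Joins b v y → Joins c v z →
    (∀ h → h ∈ δ G ⁅ v ⁆ → h ∈ₗ a ∷ b ∷ c ∷ []) → Reach G (awayFrom v) y z
  spokes-linked bridgeless {v} {a} {b} {c} {x} {y} {z} y≢v z≢v ja jb jc only
    with reach? (awayFrom v) y z | reach? (awayFrom v) y x
  ... | yes y~z | _       = y~z
  ... | no  y≁z | yes y~x = contradiction (bridgeless c z v) (spoke-bridge z≢v far-from-z)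
    where
    far-from-z : ∀ h → h ∈ δ G ⁅ v ⁆ → h ≢ c → ∃ λ w → Joins h v w × ¬ Reach G (awayFrom v) z w
    far-from-z h h∈ h≢c with only h h∈
    ... | here refl                 = x , ja , λ z~x → y≁z (y~x ◅◅ reach-sym z~x)
    ... | there (here refl)         = y , jb , λ z~y → y≁z (reach-sym z~y)
    ... | there (there (here refl)) = contradiction refl h≢c
  ... | no  y≁z | no  y≁x = contradiction (bridgeless b y v) (spoke-bridge y≢v far-from-y)
    where
    far-from-y : ∀ h → h ∈ δ G ⁅ v ⁆ → h ≢ b → ∃ λ w → Joins h v w × ¬ Reach G (awayFrom v) y w
    far-from-y h h∈ h≢b with only h h∈
    ... | here refl                 = x , ja , y≁x
    ... | there (here refl)         = contradiction refl h≢b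
    ... | there (there (here refl)) = z , jc , y≁z

  spokes-coindependent : ∀ {v a b c x y z} → c ≢ a → c ≢ b →
    Joins a v x → Joins b v y → Joins c v z →
    Reach G (awayFrom v) x z → Reach G (awayFrom v) y z → CoIndependent G (⁅ a ⁆ ∪ ⁅ b ⁆)
  spokes-coindependent {v} {a} {b} {c} {x} {y} {z} c≢a c≢b ja jb jc x~z y~z _ _ = reroute detour
    where
    Y = ⁅ a ⁆ ∪ ⁅ b ⁆

    ∈Y⇒≡ : ∀ {h} → h ∈ Y → h ≡ a ⊎ h ≡ b
    ∈Y⇒≡ = Sum.map (x∈⁅y⁆⇒x≡y a) (x∈⁅y⁆⇒x≡y b) ∘ x∈p∪q⁻ ⁅ a ⁆ ⁅ b ⁆

    awayFrom⊆∁Y : awayFrom v ⊆ ∁ Y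
    awayFrom⊆∁Y {h} h∈ = x∉p⇒x∈∁p λ h∈Y → x∈∁p⇒x∉p h∈ (at-v (∈Y⇒≡ h∈Y))
      where
      at-v : h ≡ a ⊎ h ≡ b → h ∈ δ G ⁅ v ⁆
      at-v (inj₁ refl) = joins⇒∈δ (x∈⁅x⁆ v) ja
      at-v (inj₂ refl) = joins⇒∈δ (x∈⁅x⁆ v) jb

    via-c : ∀ {t} → Reach G (awayFrom v) t z → Reach G (∁ Y) v t
    via-c t~z = edge c∈∁Y jc ◅◅ reach-sym (reach-mono awayFrom⊆∁Y t~z)
      where c∈∁Y = x∉p⇒x∈∁p (Sum.[ c≢a , c≢b ] ∘ ∈Y⇒≡)

    detour : ∀ h → h ∈ ⊤ → h ∉ ∁ Y → ∃₂ λ s t → Joins h s t × Reach G (∁ Y) s t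
    detour h _ h∉ with ∈Y⇒≡ (x∉∁p⇒x∈p h∉)
    ... | inj₁ refl = v , x , ja , via-c x~z
    ... | inj₂ refl = v , y , jb , via-c y~z

  data Shape (v : V G) : Set where
    loop+spoke   : ∀ l e {x} → Joins l v v → x ≢ v → Joins e v x →
                   (∀ h → h ∈ δ G ⁅ v ⁆ → h ∈ₗ l ∷ e ∷ []) → Shape v
    three-spokes : ∀ a b c {x y z} → Unique (a ∷ b ∷ c ∷ []) → x ≢ v → y ≢ v → z ≢ v →
                   Joins a v x → Joins b v y → Joins c v z →
                   (∀ h → h ∈ δ G ⁅ v ⁆ → h ∈ₗ a ∷ b ∷ c ∷ []) → Shape v

-- Trivalent graphs

module _ (G : Graph) (trivalent : Trivalent G) where

  incidence-sum≤3 : ∀ v {hs} → Unique hs → sum (map (incidence G v) hs) ≤ 3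
  incidence-sum≤3 v {hs} uniq =
    subst (sum (map (incidence G v) hs) ≤_) (trans (sym (degree≡∑ G v)) (trivalent v))
          (sum≤∑ (incidence G v) uniq)

  distinct-incident≤3 : ∀ v {hs} → Unique hs → All (_∈ δ G ⁅ v ⁆) hs → length hs ≤ 3
  distinct-incident≤3 v uniq at-v =
    ≤-trans (length≤sum (incidence G v) (All.map (∈δ⁅⁆⇒incident G) at-v)) (incidence-sum≤3 v uniq)

  three-edges-cover : ∀ {v hs} → Unique hs → length hs ≡ 3 → All (_∈ δ G ⁅ v ⁆) hs →
                      ∀ h → h ∈ δ G ⁅ v ⁆ → h ∈ₗ hs
  three-edges-cover {v} {hs} uniq length≡3 at-v h h∈ with Any.any? (h ≟_) hs
  ... | yes h∈hs = h∈hs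
  ... | no  h∉hs = contradiction (distinct-incident≤3 v (¬Any⇒All¬ hs h∉hs ∷ uniq) (h∈ ∷ at-v))
                                 (subst (λ k → ¬ suc k ≤ 3) (sym length≡3) λ { (s≤s (s≤s (s≤s ()))) })

  spoke-among-three : ∀ {v h h′ h″} → Unique (h ∷ h′ ∷ h″ ∷ []) →
    All (_∈ δ G ⁅ v ⁆) (h ∷ h′ ∷ h″ ∷ []) → ∃ λ x → x ≢ v × Joins G h v x
  spoke-among-three {v} {h} uniq (h∈ ∷ h′∈ ∷ h″∈ ∷ []) =
    incidence≡1⇒spoke G (≤-antisym h↦≤1 (∈δ⁅⁆⇒incident G h∈))
    where
    others≥2 = +-mono-≤ (∈δ⁅⁆⇒incident G h′∈) (+-mono-≤ (∈δ⁅⁆⇒incident G h″∈) z≤n)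

    h↦≤1 : incidence G v h ≤ 1
    h↦≤1 = +-cancelʳ-≤ 2 _ 1 (≤-trans (+-monoʳ-≤ (incidence G v h) others≥2) (incidence-sum≤3 v uniq))

  shape : ∀ v → Shape G v
  shape v with split (incidence G v) (incidence≤2 G v) (trans (sym (degree≡∑ G v)) (trivalent v))
  ... | two+one l e l↦2 e↦1 covers =
    let x , x≢v , je = incidence≡1⇒spoke G e↦1
    in loop+spoke l e (incidence≡2⇒loop G l↦2) x≢v je (λ h → covers h ∘ ∈δ⁅⁆⇒incident G)
  ... | one+one+one a b c uniq a↦1 b↦1 c↦1 covers =
    let x , x≢v , ja = incidence≡1⇒spoke G a↦1
        y , y≢v , jb = incidence≡1⇒spoke G b↦1
        z , z≢v , jc = incidence≡1⇒spoke G c↦1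
    in three-spokes a b c uniq x≢v y≢v z≢v ja jb jc (λ h → covers h ∘ ∈δ⁅⁆⇒incident G)

  coindependent-pair-at : Bridgeless G → ∀ v → ∃ λ Y → Y ⊆ δ G ⁅ v ⁆ × CoIndependent G Y × 2 ≤ ∣ Y ∣
  coindependent-pair-at bridgeless v with shape v
  ... | loop+spoke l e jl x≢v je only =
    contradiction (bridgeless e v _) (loop+spoke-bridge G jl only x≢v)
  ... | three-spokes a b c ((a≢b ∷ a≢c ∷ []) ∷ (b≢c ∷ []) ∷ [] ∷ []) x≢v y≢v z≢v ja jb jc only =
    ⁅ a ⁆ ∪ ⁅ b ⁆ , pair⊆δv ,
    spokes-coindependent G (≢-sym a≢c) (≢-sym b≢c) ja jb jc x~z y~z , 2≤∣⁅x⁆∪⁅y⁆∣ a≢b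
    where
    y~z = spokes-linked G bridgeless y≢v z≢v ja jb jc only
    x~z = spokes-linked G bridgeless x≢v z≢v jb ja jc λ h → ∈-resp-↭ (↭-swap a b ↭-refl) ∘ only h

    pair⊆δv : ⁅ a ⁆ ∪ ⁅ b ⁆ ⊆ δ G ⁅ v ⁆
    pair⊆δv h∈ with x∈p∪q⁻ ⁅ a ⁆ ⁅ b ⁆ h∈
    ... | inj₁ h∈⁅a⁆ rewrite x∈⁅y⁆⇒x≡y a h∈⁅a⁆ = joins⇒∈δ G (x∈⁅x⁆ v) ja
    ... | inj₂ h∈⁅b⁆ rewrite x∈⁅y⁆⇒x≡y b h∈⁅b⁆ = joins⇒∈δ G (x∈⁅x⁆ v) jb

  loopless : TwoEdgeConnected G → Loopless G
  loopless (_ , bridgeless) C ((v , v∈C) , dependent , _) ∣C∣≡1 =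
    let Y , Y⊆δv , coind , 2≤∣Y∣ = coindependent-pair-at bridgeless v
        ∣Y∣≤1 = subst (∣ Y ∣ ≤_) ∣C∣≡1
                  (dependent Y (λ y∈Y → δ-mono G (x∈p⇒⁅x⁆⊆p v∈C) (Y⊆δv y∈Y)) coind)
    in contradiction (≤-trans 2≤∣Y∣ ∣Y∣≤1) λ { (s≤s ()) }

  -- If e ∉ Y, then e, h₁, h₂ are all the edges at p, so in G − Y the vertex p hangs on e alone
  -- and the far end r of h₁ is cut off from q.
  bridge-end-corank≤1 : ∀ {e p q} → Connected G → Joins G e p q → ¬ Reach G (∁ ⁅ e ⁆) p q →
    ∀ {Y h₁ h₂} → Y ⊆ δ G ⁅ p ⁆ → CoIndependent G Y → h₁ ∈ Y → h₂ ∈ Y → h₁ ≢ h₂ → ⊥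
  bridge-end-corank≤1 {e} {p} {q} conn je p↛q {Y} {h₁} {h₂} Y⊆δp coind h₁∈Y h₂∈Y h₁≢h₂
    with e ∈? Y
  ... | yes e∈Y = p↛q (reach-mono G (p⊆q⇒∁p⊇∁q (x∈p⇒⁅x⁆⊆p e∈Y)) (coind p q (conn p q)))
  ... | no  e∉Y = r↛q (reach-within G blocked (coind r q (conn r q)))
    where
    ∈Y⇒≢e : ∀ {h} → h ∈ Y → h ≢ e
    ∈Y⇒≢e h∈Y refl = e∉Y h∈Y

    uniq : Unique (h₁ ∷ e ∷ h₂ ∷ [])
    uniq = (∈Y⇒≢e h₁∈Y ∷ h₁≢h₂ ∷ []) ∷ (≢-sym (∈Y⇒≢e h₂∈Y) ∷ []) ∷ [] ∷ []

    at-p : All (_∈ δ G ⁅ p ⁆) (h₁ ∷ e ∷ h₂ ∷ [])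
    at-p = Y⊆δp h₁∈Y ∷ joins⇒∈δ G (x∈⁅x⁆ p) je ∷ Y⊆δp h₂∈Y ∷ []

    spoke₁ : ∃ λ r → r ≢ p × Joins G h₁ p r
    spoke₁ = spoke-among-three uniq at-p

    r = proj₁ spoke₁

    T = ∁ (⁅ e ⁆ ∪ Y)

    r↛q : ¬ Reach G T r q
    r↛q r~q = p↛q (edge G (≢⇒∈∁⁅⁆ (∈Y⇒≢e h₁∈Y)) (proj₂ (proj₂ spoke₁))
                   ◅◅ reach-mono G (p⊆q⇒∁p⊇∁q (p⊆p∪q Y)) r~q)

    p-isolated : ∀ h → h ∈ T → ∀ {w} → ¬ Joins G h p w
    p-isolated h h∈T j with three-edges-cover {p} uniq refl at-p h (joins⇒∈δ G (x∈⁅x⁆ p) j)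
    ... | here refl                 = x∈∁p⇒x∉p h∈T (x∈p∪q⁺ (inj₂ h₁∈Y))
    ... | there (here refl)         = x∈∁p⇒x∉p h∈T (x∈p∪q⁺ (inj₁ (x∈⁅x⁆ e)))
    ... | there (there (here refl)) = x∈∁p⇒x∉p h∈T (x∈p∪q⁺ (inj₂ h₂∈Y))

    blocked : ∀ h → h ∈ ∁ Y → h ∉ T → ∀ {x x′} → Joins G h x x′ → ¬ Reach G T r x
    blocked h h∈∁Y h∉T j with x∈p∪q⁻ ⁅ e ⁆ Y (x∉∁p⇒x∈p h∉T)
    ... | inj₂ h∈Y = contradiction h∈Y (x∈∁p⇒x∉p h∈∁Y)
    ... | inj₁ h∈⁅e⁆ with refl ← x∈⁅y⁆⇒x≡y e h∈⁅e⁆ with joins-endpoint G je j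
    ... | inj₁ refl = proj₁ (proj₂ spoke₁) ∘ isolated G p-isolated
    ... | inj₂ refl = r↛q

  bridge-end-circuit : ∀ {e p q} → Connected G → Joins G e p q → ¬ Reach G (∁ ⁅ e ⁆) p q →
                       IsCircuit G ⁅ p ⁆
  bridge-end-circuit {p = p} conn je p↛q =
    (p , x∈⁅x⁆ p) , dependent , λ B nonempty B⊆⁅p⁆ _ → nonempty⊆⁅x⁆⇒≡ nonempty B⊆⁅p⁆
    where
    dependent : Dep G ⁅ p ⁆
    dependent Y Y⊆δp coind with ∣ Y ∣ ≤? 1
    ... | yes ∣Y∣≤1 = subst (∣ Y ∣ ≤_) (sym (∣⁅x⁆∣≡1 p)) ∣Y∣≤1
    ... | no  ∣Y∣≰1 =
      let h₁ , h₂ , h₁∈Y , h₂∈Y , h₁≢h₂ = two-members Y (≰⇒> ∣Y∣≰1)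
      in ⊥-elim (bridge-end-corank≤1 conn je p↛q Y⊆δp coind h₁∈Y h₂∈Y h₁≢h₂)

  loopless⇒bridgeless : Connected G → Loopless G → Bridgeless G
  loopless⇒bridgeless conn loopless-G e = decidable-stable (connectedOn? G _) λ disconnected →
    loopless-G ⁅ p ⁆ (bridge-end-circuit conn je (disconnected ∘ connected-minus-edge G conn je))
               (∣⁅x⁆∣≡1 p)
    where
    p = proj₁ (ends G e)

    je : Joins G e p (proj₂ (ends G e))
    je = inj₁ refl

  circuit-corank : TwoEdgeConnected G → ∀ C → IsCircuit G C → CoRankEq G (δ G C) ∣ C ∣
  circuit-corank 2ec C circuit@((v , v∈C) , dependent , minimal) =
    let Y , Y⊆δB , coind , ∣Y∣≡1+∣B∣ = corank-exceeds G B-independent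
    in dependent , Y , (λ y∈Y → δ-mono G B⊆C (Y⊆δB y∈Y)) , coind , trans ∣Y∣≡1+∣B∣ (sym ∣C∣≡1+∣B∣)
    where
    B = C - v

    B⊆C : B ⊆ C
    B⊆C = p─q⊆p C ⁅ v ⁆

    ∣C∣≡1+∣B∣ : ∣ C ∣ ≡ suc ∣ B ∣
    ∣C∣≡1+∣B∣ = ∣p∣≡1+∣p-x∣ C v∈C

    B-nonempty : Nonempty B
    B-nonempty = nonempty-of-size B (n≢0⇒n>0 λ ∣B∣≡0 →
      loopless 2ec C circuit (trans ∣C∣≡1+∣B∣ (cong suc ∣B∣≡0)))

    B-independent : ¬ Dep G B
    B-independent dep =
      1+n≢n (trans (sym ∣C∣≡1+∣B∣) (cong ∣_∣ (sym (minimal B B-nonempty B⊆C dep))))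

lemma2p7 : (G : Graph) → Trivalent G → Connected G →
    (Loopless G ⇔ TwoEdgeConnected G)
    × (TwoEdgeConnected G → ∀ C → IsCircuit G C → CoRankEq G (δ G C) ∣ C ∣)
lemma2p7 G trivalent connected =
  mk⇔ (λ loopless-G → connected , loopless⇒bridgeless G trivalent connected loopless-G)
      (loopless G trivalent) ,
  circuit-corank G trivalent
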